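{- Let $\Gamma$ be a simple graph on a finite set $X$ ($|X|=n\ge 3$) with matrix $\mathcal{E}$. If the group $G(\Gamma)$ acts doubly transitively on $X$, then the (real symmetric) matrix $\mathcal{E}$ has at most two distinct eigenvalues.
   Context: The matrix of a simple graph $\Gamma$ on $X$ is $\mathcal{E}=(\varepsilon_{i,j})$ with $\varepsilon_{i,j}=-1$ if $i\neq j$ are adjacent and $\varepsilon_{i,j}=1$ otherwise (so the diagonal entries are $1$). Matrices $\mathcal{E},\mathcal{E}'$ are associated if there exist $\nu_i\in\{ -1,1\}$ with $\varepsilon'_{i,j}=\nu_i\nu_j\varepsilon_{i,j}$ for all $i,j$. $G(\Gamma)$ is the group of permutations $\sigma$ of $X$ such that $\mathcal{E}$ and ${}^\sigma\mathcal{E}$ are associated, where $({}^\sigma\mathcal{E})_{i,j}=\mathcal{E}_{\sigma^{ -1}(i),\sigma^{ -1}(j)}$. -}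

module Defs where

open import Level using (Level; _⊔_) renaming (suc to lsuc)
open import Data.Nat using (ℕ; zero; suc; _≤_)
open import Data.Fin using (Fin; zero; suc)
open import Data.Fin.Permutation using (Permutation′; _⟨$⟩ʳ_; _⟨$⟩ˡ_)
open import Data.Integer as ℤ using (ℤ; +_; -[1+_])
open import Data.Bool using (Bool; true; false; if_then_else_)
open import Data.Product using (Σ; ∃; _×_; _,_)
open import Data.Sum using (_⊎_)
open import Relation.Nullary using (¬_)
open import Relation.Binary.PropositionalEquality using (_≡_)
open import Algebra.Bundles using (CommutativeRing)

record SimpleGraph (n : ℕ) : Set where
  field
    adj    : Fin n → Fin n → Bool
    sym    : ∀ i j → adj i j ≡ adj j i
    irrefl : ∀ i → adj i i ≡ false

matrix : ∀ {n} → SimpleGraph n → Fin n → Fin n → ℤ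
matrix Γ i j = if SimpleGraph.adj Γ i j then ℤ.-[1+ 0 ] else ℤ.+ 1

IsSign : ℤ → Set
IsSign x = (x ≡ ℤ.+ 1) ⊎ (x ≡ ℤ.-[1+ 0 ])

Associated : ∀ {n} → (Fin n → Fin n → ℤ) → (Fin n → Fin n → ℤ) → Set
Associated {n} E E′ =
  Σ (Fin n → ℤ) λ ν → (∀ i → IsSign (ν i)) ×
    (∀ i j → E′ i j ≡ (ν i ℤ.* ν j) ℤ.* E i j)

permuteMatrix : ∀ {n} → Permutation′ n → (Fin n → Fin n → ℤ) → Fin n → Fin n → ℤ
permuteMatrix σ E i j = E (σ ⟨$⟩ˡ i) (σ ⟨$⟩ˡ j)

InG : ∀ {n} → SimpleGraph n → Permutation′ n → Set
InG Γ σ = Associated (matrix Γ) (permuteMatrix σ (matrix Γ))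

DoublyTransitive : ∀ {n} → SimpleGraph n → Set
DoublyTransitive {n} Γ =
  ∀ (x y x′ y′ : Fin n) → ¬ x ≡ y → ¬ x′ ≡ y′ →
    Σ (Permutation′ n) λ σ → InG Γ σ × (σ ⟨$⟩ʳ x ≡ x′) × (σ ⟨$⟩ʳ y ≡ y′)

record Field (c ℓ : Level) : Set (lsuc (c ⊔ ℓ)) where
  field
    commutativeRing : CommutativeRing c ℓ
  open CommutativeRing commutativeRing public
  field
    1≉0     : ¬ (1# ≈ 0#)
    inverse : ∀ x → ¬ (x ≈ 0#) → ∃ λ y → (x * y) ≈ 1#

module FieldOps {c ℓ} (F : Field c ℓ) where
  open Field F using (Carrier; _≈_; _+_; _*_; -_; 0#; 1#)

  fromℕ : ℕ → Carrier
  fromℕ zero    = 0#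
  fromℕ (suc k) = 1# + fromℕ k

  fromℤ : ℤ → Carrier
  fromℤ (+ k)      = fromℕ k
  fromℤ -[1+ k ]   = - fromℕ (suc k)

  CharacteristicZero : Set ℓ
  CharacteristicZero = ∀ k → ¬ (fromℕ (suc k) ≈ 0#)

  ∑ : ∀ {n} → (Fin n → Carrier) → Carrier
  ∑ {zero}  f = 0#
  ∑ {suc n} f = f zero + ∑ (λ i → f (suc i))

  IsEigenvalue : ∀ {n} → (Fin n → Fin n → ℤ) → Carrier → Set (c ⊔ ℓ)
  IsEigenvalue {n} E μ =
    Σ (Fin n → Carrier) λ v → (∃ λ i → ¬ (v i ≈ 0#)) ×
      (∀ i → ∑ (λ j → fromℤ (E i j) * v j) ≈ μ * v i)

  AtMostTwoEigenvalues : ∀ {n} → (Fin n → Fin n → ℤ) → Set (c ⊔ ℓ)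
  AtMostTwoEigenvalues E =
    ∀ μ₁ μ₂ μ₃ → IsEigenvalue E μ₁ → IsEigenvalue E μ₂ → IsEigenvalue E μ₃ →
      ¬ ((¬ μ₁ ≈ μ₂) × (¬ μ₁ ≈ μ₃) × (¬ μ₂ ≈ μ₃))

-- An element of G(Γ) only conjugates E by a diagonal ±1 matrix (up to relabelling), which
-- multiplies both (E²)ᵢₖ and Eᵢₖ by νᵢνₖ, so the product (E²)ᵢₖ Eᵢₖ is G(Γ)-invariant.
-- Double transitivity makes it a constant s off the diagonal, and since Eᵢₖ = ±1 this
-- means (E²)ᵢₖ = s Eᵢₖ there; on the diagonal (E²)ᵢᵢ = n. Hence E² = s E + (n − s) I, and
-- every eigenvalue is a root of the quadratic x² − s x − (n − s), which has at most two
-- roots in a field.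
module Submission where

open import Defs
open import Level using (Level)
open import Data.Nat as ℕ using (ℕ; zero; suc; _≤_; z≤n; s≤s; z<s)
import Data.Nat.Properties as ℕP
open import Data.Integer as ℤ using (ℤ; +_; -[1+_]; _⊖_; sign; ∣_∣; _◃_)
import Data.Integer.Properties as ℤP
open import Data.Integer.Solver using (module +-*-Solver)
open import Data.Sign as Sign using (Sign)
open import Data.Fin using (Fin; zero; suc; _≟_)
open import Data.Fin.Permutation as Perm using (Permutation′; _⟨$⟩ʳ_; _⟨$⟩ˡ_)
open import Data.Bool using (true; false; if_then_else_)
open import Data.Maybe using (Maybe; just; nothing)
open import Data.Product using (_×_; _,_; ∃₂)
open import Data.Sum using (inj₁; inj₂)
open import Function using (_∘_)
open import Relation.Nullary using (¬_; yes; no; does)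
open import Relation.Binary.PropositionalEquality as ≡ using (_≡_; _≢_)
open import Algebra.Bundles using (CommutativeSemiring)
import Algebra.Properties.Ring as RingProperties
import Algebra.Properties.Semiring.Sum as SemiringSum
import Algebra.Solver.Ring as RingSolver
import Algebra.Solver.Ring.AlmostCommutativeRing as AlmostCommutativeRing
import Algebra.Solver.Ring.NaturalCoefficients.Default as SemiringSolver
import Relation.Binary.Reasoning.Setoid as SetoidReasoning

module SquareMatrix {c ℓ} (R : CommutativeSemiring c ℓ) where
  open CommutativeSemiring R hiding (zero)
  open SemiringSum semiring public using (sum; sum-cong-≋)
  open SemiringSum semiring using (sum-permute; sum-replicate-zero; ∑-comm; *-distribˡ-sum; *-distribʳ-sum)
  open SetoidReasoning setoid
  open SemiringSolver R using (solve; _:*_; _:=_)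

  Matrix : ℕ → Set c
  Matrix n = Fin n → Fin n → Carrier

  square : ∀ {n} → Matrix n → Matrix n
  square A i k = sum λ j → A i j * A j k

  identityMatrix : ∀ {n} → Matrix n
  identityMatrix i k = if does (i ≟ k) then 1# else 0#

  ∑-identityMatrix-* : ∀ {n} (i : Fin n) (v : Fin n → Carrier) →
                       sum (λ k → identityMatrix i k * v k) ≈ v i
  ∑-identityMatrix-* {suc n} zero v = begin
    1# * v zero + sum (λ k → 0# * v (suc k)) ≈⟨ +-cong (*-identityˡ _) (sum-cong-≋ {n} λ k → zeroˡ _) ⟩
    v zero + sum {n} (λ _ → 0#)              ≈⟨ +-congˡ (sum-replicate-zero n) ⟩
    v zero + 0#                              ≈⟨ +-identityʳ _ ⟩
    v zero                                   ∎
  ∑-identityMatrix-* {suc n} (suc i) v =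
    trans (+-cong (zeroˡ _) (∑-identityMatrix-* i (v ∘ suc))) (+-identityˡ _)

  ∑-square-* : ∀ {n} (A : Matrix n) (v : Fin n → Carrier) i →
               sum (λ k → square A i k * v k) ≈ sum (λ j → A i j * sum (λ k → A j k * v k))
  ∑-square-* {n} A v i = begin
    sum (λ k → square A i k * v k)              ≈⟨ sum-cong-≋ (λ k → *-distribʳ-sum (v k) (λ j → A i j * A j k)) ⟩
    sum (λ k → sum λ j → A i j * A j k * v k)   ≈⟨ ∑-comm (λ k j → A i j * A j k * v k) ⟩
    sum (λ j → sum λ k → A i j * A j k * v k)   ≈⟨ sum-cong-≋ {n} (λ j → sum-cong-≋ {n} λ k → *-assoc _ _ _) ⟩
    sum (λ j → sum λ k → A i j * (A j k * v k)) ≈⟨ sum-cong-≋ (λ j → *-distribˡ-sum (A i j) (λ k → A j k * v k)) ⟨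
    sum (λ j → A i j * sum (λ k → A j k * v k)) ∎

  square-rearrange : ∀ {n} (π : Permutation′ n) (A : Matrix n) i k →
                     square (λ i j → A (π ⟨$⟩ʳ i) (π ⟨$⟩ʳ j)) i k ≈ square A (π ⟨$⟩ʳ i) (π ⟨$⟩ʳ k)
  square-rearrange π A i k = sym (sum-permute (λ j → A (π ⟨$⟩ʳ i) j * A j (π ⟨$⟩ʳ k)) π)

  module Rescaling {n} (ν : Fin n → Carrier) (ν²≈1 : ∀ i → ν i * ν i ≈ 1#)
                   (A B : Matrix n) (B≈νAν : ∀ i j → B i j ≈ (ν i * ν j) * A i j) where

    square-rescale : ∀ i k → square B i k ≈ (ν i * ν k) * square A i k
    square-rescale i k = begin
      sum (λ j → B i j * B j k)                                   ≈⟨ sum-cong-≋ (λ j → *-cong (B≈νAν i j) (B≈νAν j k)) ⟩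
      sum (λ j → ((ν i * ν j) * A i j) * ((ν j * ν k) * A j k))   ≈⟨ sum-cong-≋ (λ j → rearrange (ν i) (ν j) (ν k) (A i j) (A j k)) ⟩
      sum (λ j → ((ν i * ν k) * (A i j * A j k)) * (ν j * ν j))   ≈⟨ sum-cong-≋ (λ j → trans (*-congˡ (ν²≈1 j)) (*-identityʳ _)) ⟩
      sum (λ j → (ν i * ν k) * (A i j * A j k))                   ≈⟨ *-distribˡ-sum (ν i * ν k) (λ j → A i j * A j k) ⟨
      (ν i * ν k) * square A i k                                  ∎
      where
      rearrange : ∀ a b d x y → ((a * b) * x) * ((b * d) * y) ≈ ((a * d) * (x * y)) * (b * b)
      rearrange = solve 5 (λ a b d x y → ((a :* b) :* x) :* ((b :* d) :* y) := ((a :* d) :* (x :* y)) :* (b :* b)) refl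

    square*entry-rescale : ∀ i k → square B i k * B i k ≈ square A i k * A i k
    square*entry-rescale i k = begin
      square B i k * B i k                                     ≈⟨ *-cong (square-rescale i k) (B≈νAν i k) ⟩
      ((ν i * ν k) * square A i k) * ((ν i * ν k) * A i k)     ≈⟨ rearrange (ν i) (ν k) (square A i k) (A i k) ⟩
      ((square A i k * A i k) * (ν i * ν i)) * (ν k * ν k)     ≈⟨ *-cong (*-congˡ (ν²≈1 i)) (ν²≈1 k) ⟩
      ((square A i k * A i k) * 1#) * 1#                       ≈⟨ trans (*-identityʳ _) (*-identityʳ _) ⟩
      square A i k * A i k                                     ∎
      where
      rearrange : ∀ a b s x → ((a * b) * s) * ((a * b) * x) ≈ ((s * x) * (a * a)) * (b * b)
      rearrange = solve 4 (λ a b s x → ((a :* b) :* s) :* ((a :* b) :* x) := ((s :* x) :* (a :* a)) :* (b :* b)) refl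

module ℤ-Matrix = SquareMatrix ℤP.+-*-commutativeSemiring

IsSign⇒*-self≡1 : ∀ {ν} → IsSign ν → ν ℤ.* ν ≡ + 1
IsSign⇒*-self≡1 (inj₁ ≡.refl) = ≡.refl
IsSign⇒*-self≡1 (inj₂ ≡.refl) = ≡.refl

ℤ-sum-ones : ∀ m → ℤ-Matrix.sum {m} (λ _ → + 1) ≡ + m
ℤ-sum-ones zero    = ≡.refl
ℤ-sum-ones (suc m) = ≡.cong (λ k → + 1 ℤ.+ k) (ℤ-sum-ones m)

module GraphMatrix {n} (Γ : SimpleGraph n) where
  open import Data.Integer using (_+_; _*_; _-_)
  open ℤ-Matrix
  open ≡ using (refl; cong; cong₂)
  open ≡.≡-Reasoning
  open +-*-Solver using (solve; _:+_; _:*_; _:-_; _:=_; con)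

  E : Matrix n
  E = matrix Γ

  matrix-*-self : ∀ i j → E i j * E i j ≡ + 1
  matrix-*-self i j with SimpleGraph.adj Γ i j
  ... | true  = refl
  ... | false = refl

  matrix-sym : ∀ i j → E i j ≡ E j i
  matrix-sym i j = cong (λ b → if b then -[1+ 0 ] else + 1) (SimpleGraph.sym Γ i j)

  matrix-diagonal : ∀ i → E i i ≡ + 1
  matrix-diagonal i rewrite SimpleGraph.irrefl Γ i = refl

  square-diagonal : ∀ i → square E i i ≡ + n
  square-diagonal i = begin
    sum (λ j → E i j * E j i) ≡⟨ sum-cong-≋ {n} (λ j → ≡.trans (cong (E i j *_) (matrix-sym j i)) (matrix-*-self i j)) ⟩
    sum {n} (λ _ → + 1)       ≡⟨ ℤ-sum-ones n ⟩
    + n                       ∎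

  square*entry-invariant : ∀ σ → InG Γ σ → ∀ i k →
    square E (σ ⟨$⟩ˡ i) (σ ⟨$⟩ˡ k) * E (σ ⟨$⟩ˡ i) (σ ⟨$⟩ˡ k) ≡ square E i k * E i k
  square*entry-invariant σ (ν , ν-sign , Eσ≡νEν) i k = begin
    square E (σ ⟨$⟩ˡ i) (σ ⟨$⟩ˡ k) * Eσ i k ≡⟨ cong (ℤ._* Eσ i k) (square-rearrange (Perm.flip σ) E i k) ⟨
    square Eσ i k * Eσ i k                 ≡⟨ square*entry-rescale i k ⟩
    square E i k * E i k                   ∎
    where
    Eσ : Matrix n
    Eσ = permuteMatrix σ E
    open Rescaling ν (IsSign⇒*-self≡1 ∘ ν-sign) E Eσ Eσ≡νEν

  square*entry-constant : DoublyTransitive Γ → ∀ {x y i k} → x ≢ y → i ≢ k →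
                          square E i k * E i k ≡ square E x y * E x y
  square*entry-constant transitive {x} {y} {i} {k} x≢y i≢k
    with transitive x y i k x≢y i≢k
  ... | σ , σ∈G , refl , refl = begin
    square E (σ ⟨$⟩ʳ x) (σ ⟨$⟩ʳ y) * E (σ ⟨$⟩ʳ x) (σ ⟨$⟩ʳ y) ≡⟨ square*entry-invariant σ σ∈G _ _ ⟨
    t (σ ⟨$⟩ˡ (σ ⟨$⟩ʳ x)) (σ ⟨$⟩ˡ (σ ⟨$⟩ʳ y))                   ≡⟨ cong₂ t (Perm.inverseˡ σ) (Perm.inverseˡ σ) ⟩
    t x y                                                       ∎
    where
    t : Fin n → Fin n → ℤ
    t a b = square E a b * E a b

  square≡s*matrix+t*identity : DoublyTransitive Γ → ∀ {x y} → x ≢ y →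
    ∃₂ λ s t → ∀ i k → square E i k ≡ s * E i k + t * identityMatrix i k
  square≡s*matrix+t*identity transitive {x} {y} x≢y = s , + n - s , E²≡sE+[n-s]I
    where
    s : ℤ
    s = square E x y * E x y

    E²≡sE+[n-s]I : ∀ i k → square E i k ≡ s * E i k + (+ n - s) * identityMatrix i k
    E²≡sE+[n-s]I i k with i ≟ k
    ... | yes refl = begin
      square E i i                    ≡⟨ square-diagonal i ⟩
      + n                             ≡⟨ solve 2 (λ n s → n := s :* con (+ 1) :+ (n :- s) :* con (+ 1)) refl (+ n) s ⟩
      s * + 1 + (+ n - s) * + 1       ≡⟨ cong (λ e → s * e + (+ n - s) * + 1) (matrix-diagonal i) ⟨
      s * E i i + (+ n - s) * + 1     ∎
    ... | no i≢k = begin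
      square E i k                    ≡⟨ ℤP.*-identityʳ _ ⟨
      square E i k * + 1              ≡⟨ cong (square E i k *_) (matrix-*-self i k) ⟨
      square E i k * (E i k * E i k)  ≡⟨ ℤP.*-assoc (square E i k) (E i k) (E i k) ⟨
      square E i k * E i k * E i k    ≡⟨ cong (_* E i k) (square*entry-constant transitive x≢y i≢k) ⟩
      s * E i k                       ≡⟨ ℤP.+-identityʳ _ ⟨
      s * E i k + + 0                 ≡⟨ cong (λ e → s * E i k + e) (ℤP.*-zeroʳ (+ n - s)) ⟨
      s * E i k + (+ n - s) * + 0     ∎

module FromℤHomomorphism {c ℓ} (F : Field c ℓ) where
  open Field F hiding (zero)
  open FieldOps F
  open RingProperties ring
  open SetoidReasoning setoid
  open SquareMatrix commutativeSemiring

  fromℕ-+ : ∀ m n → fromℕ (m ℕ.+ n) ≈ fromℕ m + fromℕ n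
  fromℕ-+ zero    n = sym (+-identityˡ _)
  fromℕ-+ (suc m) n = trans (+-congˡ (fromℕ-+ m n)) (sym (+-assoc _ _ _))

  fromℕ-* : ∀ m n → fromℕ (m ℕ.* n) ≈ fromℕ m * fromℕ n
  fromℕ-* zero    n = sym (zeroˡ _)
  fromℕ-* (suc m) n = begin
    fromℕ (n ℕ.+ m ℕ.* n)             ≈⟨ fromℕ-+ n (m ℕ.* n) ⟩
    fromℕ n + fromℕ (m ℕ.* n)         ≈⟨ +-congˡ (fromℕ-* m n) ⟩
    fromℕ n + fromℕ m * fromℕ n       ≈⟨ +-congʳ (*-identityˡ _) ⟨
    1# * fromℕ n + fromℕ m * fromℕ n  ≈⟨ distribʳ _ _ _ ⟨
    (1# + fromℕ m) * fromℕ n          ∎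

  fromℤ-⊖ : ∀ m n → fromℤ (m ⊖ n) ≈ fromℕ m - fromℕ n
  fromℤ-⊖ m zero rewrite ℤP.⊖-≥ {m} {0} z≤n = sym (trans (+-congˡ -0#≈0#) (+-identityʳ _))
  fromℤ-⊖ zero (suc n) rewrite ℤP.⊖-< {0} {suc n} z<s = sym (+-identityˡ _)
  fromℤ-⊖ (suc m) (suc n) rewrite ℤP.[1+m]⊖[1+n]≡m⊖n m n =
    trans (fromℤ-⊖ m n) (sym (cancel-1# (fromℕ m) (fromℕ n)))
    where
    open SemiringSolver commutativeSemiring using (solve; _:+_; _:=_)
    cancel-1# : ∀ a b → 1# + a - (1# + b) ≈ a - b
    cancel-1# a b = begin
      1# + a + - (1# + b)      ≈⟨ +-congˡ (-‿+-comm 1# b) ⟨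
      1# + a + (- 1# + - b)    ≈⟨ solve 4 (λ x a y b → x :+ a :+ (y :+ b) := a :+ b :+ (x :+ y)) refl 1# a (- 1#) (- b) ⟩
      a + - b + (1# + - 1#)    ≈⟨ +-congˡ (-‿inverseʳ 1#) ⟩
      a + - b + 0#             ≈⟨ +-identityʳ _ ⟩
      a - b                    ∎

  fromSign : Sign → Carrier
  fromSign Sign.+ = 1#
  fromSign Sign.- = - 1#

  fromSign-* : ∀ s t → fromSign (s Sign.* t) ≈ fromSign s * fromSign t
  fromSign-* Sign.+ Sign.+ = sym (*-identityˡ _)
  fromSign-* Sign.+ Sign.- = sym (*-identityˡ _)
  fromSign-* Sign.- Sign.+ = sym (*-identityʳ _)
  fromSign-* Sign.- Sign.- = begin
    1#            ≈⟨ -‿involutive 1# ⟨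
    - (- 1#)      ≈⟨ -‿cong (*-identityʳ _) ⟨
    - (- 1# * 1#) ≈⟨ -‿distribʳ-* (- 1#) 1# ⟩
    - 1# * - 1#   ∎

  fromℤ-◃ : ∀ s n → fromℤ (s ◃ n) ≈ fromSign s * fromℕ n
  fromℤ-◃ s      zero    = sym (zeroʳ _)
  fromℤ-◃ Sign.+ (suc n) = sym (*-identityˡ _)
  fromℤ-◃ Sign.- (suc n) = sym (-1*x≈-x _)

  fromℤ≈sign*abs : ∀ i → fromℤ i ≈ fromSign (sign i) * fromℕ ∣ i ∣
  fromℤ≈sign*abs (+ n)    = sym (*-identityˡ _)
  fromℤ≈sign*abs -[1+ n ] = sym (-1*x≈-x _)

  fromℤ-* : ∀ i j → fromℤ (i ℤ.* j) ≈ fromℤ i * fromℤ j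
  fromℤ-* i j = begin
    fromℤ (i ℤ.* j)                                         ≈⟨ fromℤ-◃ (sign i Sign.* sign j) (∣ i ∣ ℕ.* ∣ j ∣) ⟩
    fromSign (sign i Sign.* sign j) * fromℕ (∣ i ∣ ℕ.* ∣ j ∣) ≈⟨ *-cong (fromSign-* (sign i) (sign j)) (fromℕ-* ∣ i ∣ ∣ j ∣) ⟩
    (fromSign (sign i) * fromSign (sign j)) * (fromℕ ∣ i ∣ * fromℕ ∣ j ∣)
      ≈⟨ solve 4 (λ a b x y → (a :* b) :* (x :* y) := (a :* x) :* (b :* y)) refl _ _ _ _ ⟩
    (fromSign (sign i) * fromℕ ∣ i ∣) * (fromSign (sign j) * fromℕ ∣ j ∣)
      ≈⟨ *-cong (fromℤ≈sign*abs i) (fromℤ≈sign*abs j) ⟨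
    fromℤ i * fromℤ j                                       ∎
    where open SemiringSolver commutativeSemiring using (solve; _:*_; _:=_)

  fromℤ-neg : ∀ i → fromℤ (ℤ.- i) ≈ - fromℤ i
  fromℤ-neg (+ zero)  = sym -0#≈0#
  fromℤ-neg (+ suc n) = refl
  fromℤ-neg -[1+ n ]  = sym (-‿involutive _)

  fromℤ-+ : ∀ i j → fromℤ (i ℤ.+ j) ≈ fromℤ i + fromℤ j
  fromℤ-+ (+ m)    (+ n)    = fromℕ-+ m n
  fromℤ-+ (+ m)    -[1+ n ] = fromℤ-⊖ m (suc n)
  fromℤ-+ -[1+ m ] (+ n)    = trans (fromℤ-⊖ n (suc m)) (+-comm _ _)
  fromℤ-+ -[1+ m ] -[1+ n ] = begin
    - fromℕ (suc (suc (m ℕ.+ n)))       ≈⟨ -‿cong (reflexive (≡.cong (fromℕ ∘ suc) (ℕP.+-suc m n))) ⟨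
    - fromℕ (suc m ℕ.+ suc n)           ≈⟨ -‿cong (fromℕ-+ (suc m) (suc n)) ⟩
    - (fromℕ (suc m) + fromℕ (suc n))   ≈⟨ -‿+-comm _ _ ⟨
    - fromℕ (suc m) + - fromℕ (suc n)   ∎

  fromℤ-morphism : ℤ.+-*-rawRing AlmostCommutativeRing.-Raw-AlmostCommutative⟶
                   AlmostCommutativeRing.fromCommutativeRing commutativeRing
  fromℤ-morphism = record
    { ⟦_⟧ = fromℤ ; +-homo = fromℤ-+ ; *-homo = fromℤ-* ; -‿homo = fromℤ-neg
    ; 0-homo = refl ; 1-homo = +-identityʳ 1# }

  fromℤ-≟ : ∀ i j → Maybe (fromℤ i ≈ fromℤ j)
  fromℤ-≟ i j with i ℤP.≟ j
  ... | yes ≡.refl = just refl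
  ... | no _       = nothing

  fromℤ-sum : ∀ {n} (f : Fin n → ℤ) → fromℤ (ℤ-Matrix.sum f) ≈ sum (fromℤ ∘ f)
  fromℤ-sum {zero}  f = refl
  fromℤ-sum {suc n} f = trans (fromℤ-+ (f zero) _) (+-congˡ (fromℤ-sum (f ∘ suc)))

  fromℤ-identityMatrix : ∀ {n} (i k : Fin n) → fromℤ (ℤ-Matrix.identityMatrix i k) ≈ identityMatrix i k
  fromℤ-identityMatrix i k with does (i ≟ k)
  ... | true  = +-identityʳ 1#
  ... | false = refl

  fromℤ-square-relation : ∀ {n} (E : ℤ-Matrix.Matrix n) s t →
    (∀ i k → ℤ-Matrix.square E i k ≡ s ℤ.* E i k ℤ.+ t ℤ.* ℤ-Matrix.identityMatrix i k) →
    ∀ i k → square (λ i j → fromℤ (E i j)) i k ≈ fromℤ s * fromℤ (E i k) + fromℤ t * identityMatrix i k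
  fromℤ-square-relation {n} E s t E²≡sE+tI i k = begin
    sum (λ j → fromℤ (E i j) * fromℤ (E j k))   ≈⟨ sum-cong-≋ {n} (λ j → fromℤ-* (E i j) (E j k)) ⟨
    sum (λ j → fromℤ (E i j ℤ.* E j k))         ≈⟨ fromℤ-sum (λ j → E i j ℤ.* E j k) ⟨
    fromℤ (ℤ-Matrix.square E i k)               ≡⟨ ≡.cong fromℤ (E²≡sE+tI i k) ⟩
    fromℤ (s ℤ.* E i k ℤ.+ t ℤ.* ℤ-Matrix.identityMatrix i k)
      ≈⟨ fromℤ-+ (s ℤ.* E i k) _ ⟩
    fromℤ (s ℤ.* E i k) + fromℤ (t ℤ.* ℤ-Matrix.identityMatrix i k)
      ≈⟨ +-cong (fromℤ-* s (E i k)) (trans (fromℤ-* t _) (*-congˡ (fromℤ-identityMatrix i k))) ⟩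
    fromℤ s * fromℤ (E i k) + fromℤ t * identityMatrix i k ∎

module EigenvaluesOverField {c ℓ} (F : Field c ℓ) where
  open Field F hiding (zero)
  open FieldOps F
  open RingProperties ring
  open SetoidReasoning setoid
  open SquareMatrix commutativeSemiring
  open SemiringSum semiring using (*-distribˡ-sum; ∑-distrib-+)
  open FromℤHomomorphism F
  open RingSolver ℤ.+-*-rawRing (AlmostCommutativeRing.fromCommutativeRing commutativeRing) fromℤ-morphism fromℤ-≟
    using (solve; _:+_; _:*_; _:-_; _:=_)

  x*y≈0⇒x≈0 : ∀ {x y} → ¬ y ≈ 0# → x * y ≈ 0# → x ≈ 0#
  x*y≈0⇒x≈0 {x} {y} y≉0 xy≈0 with inverse y y≉0
  ... | y⁻¹ , yy⁻¹≈1 = begin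
    x              ≈⟨ *-identityʳ x ⟨
    x * 1#         ≈⟨ *-congˡ yy⁻¹≈1 ⟨
    x * (y * y⁻¹)  ≈⟨ *-assoc x y y⁻¹ ⟨
    (x * y) * y⁻¹  ≈⟨ *-congʳ xy≈0 ⟩
    0# * y⁻¹       ≈⟨ zeroˡ y⁻¹ ⟩
    0#             ∎

  *-cancelʳ-nonzero : ∀ {x y z} → ¬ z ≈ 0# → x * z ≈ y * z → x ≈ y
  *-cancelʳ-nonzero {x} {y} {z} z≉0 xz≈yz = x∙y⁻¹≈ε⇒x≈y x y (x*y≈0⇒x≈0 z≉0 (begin
    (x - y) * z       ≈⟨ solve 3 (λ x y z → (x :- y) :* z := x :* z :- y :* z) refl x y z ⟩
    x * z - y * z     ≈⟨ x≈y⇒x∙y⁻¹≈ε xz≈yz ⟩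
    0#                ∎))

  roots-sum : ∀ {s t a b} → a * a ≈ s * a + t → b * b ≈ s * b + t → ¬ a ≈ b → a + b ≈ s
  roots-sum {s} {t} {a} {b} a-root b-root a≉b = x∙y⁻¹≈ε⇒x≈y (a + b) s (x*y≈0⇒x≈0 a-b≉0 (begin
    (a + b - s) * (a - b)                       ≈⟨ solve 4 (λ s t a b → (a :+ b :- s) :* (a :- b) := (a :* a :- (s :* a :+ t)) :- (b :* b :- (s :* b :+ t))) refl s t a b ⟩
    (a * a - (s * a + t)) - (b * b - (s * b + t)) ≈⟨ +-congˡ (-‿cong (x≈y⇒x∙y⁻¹≈ε b-root)) ⟩
    (a * a - (s * a + t)) - 0#                  ≈⟨ +-cong (x≈y⇒x∙y⁻¹≈ε a-root) -0#≈0# ⟩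
    0# + 0#                                     ≈⟨ +-identityʳ 0# ⟩
    0#                                          ∎))
    where
    a-b≉0 : ¬ a - b ≈ 0#
    a-b≉0 = a≉b ∘ x∙y⁻¹≈ε⇒x≈y a b

  no-three-distinct-roots : ∀ {s t a b d} →
    a * a ≈ s * a + t → b * b ≈ s * b + t → d * d ≈ s * d + t →
    ¬ ((¬ a ≈ b) × (¬ a ≈ d) × (¬ b ≈ d))
  no-three-distinct-roots a-root b-root d-root (a≉b , a≉d , b≉d) =
    b≉d (+-cancelˡ _ _ _ (trans (roots-sum a-root b-root a≉b) (sym (roots-sum a-root d-root a≉d))))

  ∑≡sum : ∀ {n} (f : Fin n → Carrier) → ∑ f ≡ sum f
  ∑≡sum {zero}  f = ≡.refl
  ∑≡sum {suc n} f = ≡.cong (λ x → f zero + x) (∑≡sum (f ∘ suc))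

  eigenvalue-root : ∀ {n} (A : Matrix n) {s t} →
    (∀ i k → square A i k ≈ s * A i k + t * identityMatrix i k) →
    ∀ {μ} (v : Fin n → Carrier) i → ¬ v i ≈ 0# →
    (∀ j → sum (λ k → A j k * v k) ≈ μ * v j) → μ * μ ≈ s * μ + t
  eigenvalue-root {n} A {s} {t} A²≈sA+tI {μ} v i vᵢ≉0 Av≈μv = *-cancelʳ-nonzero vᵢ≉0 (begin
    μ * μ * v i                                       ≈⟨ *-assoc μ μ (v i) ⟩
    μ * (μ * v i)                                     ≈⟨ *-congˡ (Av≈μv i) ⟨
    μ * sum (λ j → A i j * v j)                       ≈⟨ *-distribˡ-sum μ (λ j → A i j * v j) ⟩
    sum (λ j → μ * (A i j * v j))                     ≈⟨ sum-cong-≋ {n} (λ j → x*[y*z]≈y*[x*z] μ (A i j) (v j)) ⟩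
    sum (λ j → A i j * (μ * v j))                     ≈⟨ sum-cong-≋ {n} (λ j → *-congˡ (Av≈μv j)) ⟨
    sum (λ j → A i j * sum (λ k → A j k * v k))       ≈⟨ ∑-square-* A v i ⟨
    sum (λ k → square A i k * v k)                    ≈⟨ sum-cong-≋ {n} (λ k → *-congʳ (A²≈sA+tI i k)) ⟩
    sum (λ k → (s * A i k + t * I i k) * v k)         ≈⟨ sum-cong-≋ {n} (λ k → distribute s t (A i k) (I i k) (v k)) ⟩
    sum (λ k → s * (A i k * v k) + t * (I i k * v k)) ≈⟨ ∑-distrib-+ (λ k → s * (A i k * v k)) (λ k → t * (I i k * v k)) ⟩
    sum (λ k → s * (A i k * v k)) + sum (λ k → t * (I i k * v k))
      ≈⟨ +-cong (*-distribˡ-sum s (λ k → A i k * v k)) (*-distribˡ-sum t (λ k → I i k * v k)) ⟨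
    s * sum (λ k → A i k * v k) + t * sum (λ k → I i k * v k)
      ≈⟨ +-cong (*-congˡ (Av≈μv i)) (*-congˡ (∑-identityMatrix-* i v)) ⟩
    s * (μ * v i) + t * v i                           ≈⟨ solve 4 (λ s t μ x → s :* (μ :* x) :+ t :* x := (s :* μ :+ t) :* x) refl s t μ (v i) ⟩
    (s * μ + t) * v i                                 ∎)
    where
    I : Matrix n
    I = identityMatrix
    x*[y*z]≈y*[x*z] : ∀ x y z → x * (y * z) ≈ y * (x * z)
    x*[y*z]≈y*[x*z] = solve 3 (λ x y z → x :* (y :* z) := y :* (x :* z)) refl
    distribute : ∀ s t a e x → (s * a + t * e) * x ≈ s * (a * x) + t * (e * x)
    distribute = solve 5 (λ s t a e x → (s :* a :+ t :* e) :* x := s :* (a :* x) :+ t :* (e :* x)) refl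

  at-most-two-eigenvalues : ∀ {n} (E : ℤ-Matrix.Matrix n) →
    (∃₂ λ s t → ∀ i k → ℤ-Matrix.square E i k ≡ s ℤ.* E i k ℤ.+ t ℤ.* ℤ-Matrix.identityMatrix i k) →
    AtMostTwoEigenvalues E
  at-most-two-eigenvalues {n} E (s , t , E²≡sE+tI) μ₁ μ₂ μ₃ e₁ e₂ e₃ =
    no-three-distinct-roots (root e₁) (root e₂) (root e₃)
    where
    root : ∀ {μ} → IsEigenvalue E μ → μ * μ ≈ fromℤ s * μ + fromℤ t
    root (v , (i , vᵢ≉0) , Ev≈μv) =
      eigenvalue-root _ (fromℤ-square-relation E s t E²≡sE+tI) v i vᵢ≉0
        (λ j → trans (reflexive (≡.sym (∑≡sum {n} _))) (Ev≈μv j))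

proposition8 : ∀ {c ℓ : Level} (n : ℕ) → 3 ≤ n → (Γ : SimpleGraph n) →
    DoublyTransitive Γ →
    (F : Field c ℓ) → FieldOps.CharacteristicZero F →
    FieldOps.AtMostTwoEigenvalues F (matrix Γ)
proposition8 (suc (suc (suc m))) (s≤s (s≤s (s≤s _))) Γ transitive F _ =
  EigenvaluesOverField.at-most-two-eigenvalues F (matrix Γ)
    (square≡s*matrix+t*identity transitive {zero} {suc zero} λ ())
  where open GraphMatrix Γ
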